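{- Let $a,\delta$ be positive integers with $a<\delta<2a$ and $\gcd(a,\delta)=1$, put $b=a+\delta$ and $h=(3\delta+a)a$. For $n\ge 0$ let $w_n = n + a\lfloor n/a\rfloor + b\lfloor n/\delta\rfloor$, $\mathcal W_0=\{w_n:n\ge 0\}$, and $\mathcal W_3=(\mathcal W_0-\delta)\setminus\mathcal W_0$. Then in one heap-period $\mathcal W_3$ has exactly $a^2$ elements; that is, for every integer $N\ge0$, $|\mathcal W_3\cap\{N,N+1,\dots,N+h-1\}|=a^2$.
   Context: For $X\subseteq\mathbb N$ and $y\in\mathbb N$, $X-y=\{x-y : x\in X,\ x\ge y\}$. The sequence satisfies $w_{n+a\delta}=w_n+h$ for all $n\ge0$, so $h$ is the heap-period. -}

module Defs where

open import Data.Nat using (ℕ; _+_; _*_; _≤_; _<_; NonZero)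
open import Data.Nat.DivMod using (_/_)
open import Data.Product using (Σ; _×_; ∃)
open import Data.List using (List; length)
open import Data.List.Membership.Propositional using (_∈_)
open import Data.List.Relation.Unary.Unique.Propositional using (Unique)
open import Relation.Binary.PropositionalEquality using (_≡_)
open import Relation.Nullary using (¬_)
open import Function.Bundles using (_⇔_)

w : (a δ : ℕ) .{{_ : NonZero a}} .{{_ : NonZero δ}} → ℕ → ℕ
w a δ n = n + a * (n / a) + (a + δ) * (n / δ)

InW0 : (a δ : ℕ) .{{_ : NonZero a}} .{{_ : NonZero δ}} → ℕ → Set
InW0 a δ m = ∃ λ n → w a δ n ≡ m

-- m ∈ 𝒲₃ = (𝒲₀ - δ) ∖ 𝒲₀ ; m ∈ 𝒲₀ - δ iff m + δ ∈ 𝒲₀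
InW3 : (a δ : ℕ) .{{_ : NonZero a}} .{{_ : NonZero δ}} → ℕ → Set
InW3 a δ m = InW0 a δ (m + δ) × ¬ InW0 a δ m

heapPeriod : ℕ → ℕ → ℕ
heapPeriod a δ = (3 * δ + a) * a

HasCard : (ℕ → Set) → ℕ → Set
HasCard P k = Σ (List ℕ) λ xs → Unique xs × length xs ≡ k × (∀ m → (m ∈ xs) ⇔ P m)

{-# OPTIONS --safe #-}
module Submission where

-- w is strictly increasing with w (n + aδ) = w n + h, so 𝒲₀ and 𝒲₃ are h-periodic and every
-- window of length h may be replaced by [0, h) = [w 0, w (aδ)). There 𝒲₀ - δ has aδ points, and
-- (𝒲₀ - δ) ∩ 𝒲₀ consists of the w n with w n + δ ∈ 𝒲₀. Since
-- w (n + t) = w n + t + a⌊(n % a + t)/a⌋ + (a + δ)⌊(n % δ + t)/δ⌋ and a < δ < 2a, this happens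
-- exactly when w (n + c) = w n + δ for c = δ - a, i.e. when adding c to n carries modulo a but
-- not modulo δ. By the Chinese remainder theorem the residues n % a and n % δ vary independently;
-- c of the former and a of the latter qualify, so 𝒲₃ has aδ - ca = a² points per period.

open import Defs
open import Data.Nat using (ℕ; zero; suc; _+_; _*_; _∸_; _≤_; _<_; _≤?_; _<?_; _≟_; NonZero; z≤n; s≤s; z<s; s<s)
open import Data.Nat.Properties
open import Data.Nat.DivMod
open import Data.Nat.Divisibility using (_∣_; divides; ∣m+n∣m⇒∣n; n∣m*n; m∣m*n; >⇒∤)
open import Data.Nat.GCD using (gcd)
open import Data.Nat.Coprimality using (Coprime; coprime-divisor; gcd≡1⇒coprime)
import Data.Nat.Coprimality as Coprime
open import Data.Nat.Tactic.RingSolver using (solve-∀)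
open import Data.Fin using (Fin; toℕ; fromℕ<; punchOut)
open import Data.Fin.Properties using (toℕ<n; toℕ-injective; toℕ-fromℕ<; punchOut-injective; injective⇒≤; any?)
  renaming (_≟_ to _≟ᶠ_)
open import Data.Fin.Permutation using (Permutation; permutation)
open import Algebra.Properties.CommutativeMonoid.Sum +-0-commutativeMonoid using (sum; sum-cong-≗; sum-permute)
open import Algebra.Properties.CommutativeSemigroup +-commutativeSemigroup
  using () renaming (interchange to +-interchange; xy∙z≈xz∙y to [x+y]+z≡[x+z]+y)
open import Data.List using (List; length; filter; applyUpTo)
open import Data.List.Membership.Propositional using (_∈_)
open import Data.List.Membership.Propositional.Properties using (∈-filter⁺; ∈-filter⁻; ∈-applyUpTo⁺; ∈-applyUpTo⁻)
open import Data.List.Relation.Unary.Unique.Propositional.Properties using (filter⁺; applyUpTo⁺₁)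
open import Data.Product using (∃; _×_; _,_; proj₁; proj₂)
open import Data.Product.Function.NonDependent.Propositional using (_×-⇔_)
open import Data.Sum using (inj₁; inj₂)
open import Function using (_∘_; _⇔_; mk⇔; Equivalence)
open import Function.Definitions using (Injective)
open import Function.Related.TypeIsomorphisms using (¬-cong-⇔)
open import Relation.Nullary using (Dec; yes; no; ¬_; ¬?; contradiction)
open import Relation.Nullary.Decidable using (_×-dec_)
open import Relation.Unary using (Decidable)
open import Relation.Binary using (_Preserves_⟶_)
open import Relation.Binary.PropositionalEquality

∑< : ℕ → (ℕ → ℕ) → ℕ
∑< zero    f = 0
∑< (suc k) f = f 0 + ∑< k (f ∘ suc)

syntax ∑< k (λ j → e) = ∑[ j < k ] e

∑-cong : ∀ k {f g : ℕ → ℕ} → (∀ {j} → j < k → f j ≡ g j) → ∑< k f ≡ ∑< k g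
∑-cong zero    f≡g = refl
∑-cong (suc k) f≡g = cong₂ _+_ (f≡g z<s) (∑-cong k (f≡g ∘ s<s))

∑-split : ∀ m n f → ∑< (m + n) f ≡ ∑< m f + ∑[ j < n ] f (m + j)
∑-split zero    n f = refl
∑-split (suc m) n f = trans (cong (f 0 +_) (∑-split m n (f ∘ suc))) (sym (+-assoc (f 0) _ _))

∑-last : ∀ k f → ∑< (suc k) f ≡ ∑< k f + f k
∑-last k f = begin
  ∑< (suc k) f               ≡⟨ cong (λ n → ∑< n f) (+-comm 1 k) ⟩
  ∑< (k + 1) f               ≡⟨ ∑-split k 1 f ⟩
  ∑< k f + (f (k + 0) + 0)   ≡⟨ cong (∑< k f +_) (trans (+-identityʳ _) (cong f (+-identityʳ k))) ⟩
  ∑< k f + f k               ∎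
  where open ≡-Reasoning

∑-const : ∀ k x → ∑[ j < k ] x ≡ k * x
∑-const zero    x = refl
∑-const (suc k) x = cong (x +_) (∑-const k x)

∑-zero : ∀ k {f} → (∀ {j} → j < k → f j ≡ 0) → ∑< k f ≡ 0
∑-zero k f≡0 = trans (∑-cong k f≡0) (trans (∑-const k 0) (*-zeroʳ k))

∑-distrib-+ : ∀ k f g → ∑[ j < k ] (f j + g j) ≡ ∑< k f + ∑< k g
∑-distrib-+ zero    f g = refl
∑-distrib-+ (suc k) f g =
  trans (cong (f 0 + g 0 +_) (∑-distrib-+ k (f ∘ suc) (g ∘ suc))) (+-interchange (f 0) (g 0) _ _)

∑-distribˡ-* : ∀ k x f → ∑[ j < k ] (x * f j) ≡ x * ∑< k f
∑-distribˡ-* zero    x f = sym (*-zeroʳ x)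
∑-distribˡ-* (suc k) x f = trans (cong (x * f 0 +_) (∑-distribˡ-* k x (f ∘ suc))) (sym (*-distribˡ-+ x (f 0) _))

∑-distribʳ-* : ∀ k x f → ∑[ j < k ] (f j * x) ≡ ∑< k f * x
∑-distribʳ-* zero    x f = refl
∑-distribʳ-* (suc k) x f = trans (cong (f 0 * x +_) (∑-distribʳ-* k x (f ∘ suc))) (sym (*-distribʳ-+ x (f 0) _))

∑-comm : ∀ m n (f : ℕ → ℕ → ℕ) → ∑[ i < m ] ∑[ j < n ] f i j ≡ ∑[ j < n ] ∑[ i < m ] f i j
∑-comm zero    n f = sym (∑-zero n (λ _ → refl))
∑-comm (suc m) n f = trans (cong (∑< n (f 0) +_) (∑-comm m n (f ∘ suc))) (sym (∑-distrib-+ n (f 0) _))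

∑-blocks : ∀ q m f → ∑< (q * m) f ≡ ∑[ j < q ] ∑[ i < m ] f (j * m + i)
∑-blocks zero    m f = refl
∑-blocks (suc q) m f = begin
  ∑< (m + q * m) f                                       ≡⟨ ∑-split m (q * m) f ⟩
  ∑< m f + ∑< (q * m) (λ k → f (m + k))                  ≡⟨ cong (∑< m f +_) (∑-blocks q m (λ k → f (m + k))) ⟩
  ∑< m f + ∑[ j < q ] ∑[ i < m ] f (m + (j * m + i))     ≡⟨ cong (∑< m f +_) (∑-cong q λ _ → ∑-cong m λ _ →
                                                               cong f (sym (+-assoc m _ _))) ⟩
  ∑< m f + ∑[ j < q ] ∑[ i < m ] f (suc j * m + i)       ∎
  where open ≡-Reasoning

∑-periodic : ∀ L {f} → (∀ m → f (m + L) ≡ f m) → ∀ N → ∑[ j < L ] f (N + j) ≡ ∑< L f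
∑-periodic L         f-per zero    = refl
∑-periodic L {f = f} f-per (suc N) = trans (+-cancelˡ-≡ (f N) _ _ shift) (∑-periodic L f-per N)
  where
  open ≡-Reasoning
  shift : f N + ∑[ j < L ] f (suc N + j) ≡ f N + ∑[ j < L ] f (N + j)
  shift = begin
    f N + ∑[ j < L ] f (suc N + j)        ≡⟨ cong₂ _+_ (cong f (sym (+-identityʳ N))) (∑-cong L λ {j} _ → cong f (sym (+-suc N j))) ⟩
    ∑[ j < suc L ] f (N + j)              ≡⟨ ∑-last L (λ j → f (N + j)) ⟩
    ∑[ j < L ] f (N + j) + f (N + L)      ≡⟨ cong (∑[ j < L ] f (N + j) +_) (f-per N) ⟩
    ∑[ j < L ] f (N + j) + f N            ≡⟨ +-comm _ (f N) ⟩
    f N + ∑[ j < L ] f (N + j)            ∎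

injective⇒surjective : ∀ {n} {f : Fin n → Fin n} → Injective _≡_ _≡_ f → ∀ y → ∃ λ x → f x ≡ y
injective⇒surjective {zero}          f-inj ()
injective⇒surjective {suc n} {f = f} f-inj y with any? (λ x → f x ≟ᶠ y)
... | yes hit = hit
... | no miss = contradiction (injective⇒≤ g-inj) 1+n≰n
  where
  avoids : ∀ x → f x ≢ y
  avoids x fx≡y = miss (x , fx≡y)
  g : Fin (suc n) → Fin n
  g x = punchOut (avoids x ∘ sym)
  g-inj : Injective _≡_ _≡_ g
  g-inj {x} {x′} gx≡gx′ = f-inj (punchOut-injective (avoids x ∘ sym) (avoids x′ ∘ sym) gx≡gx′)

∑≡sum : ∀ k f → ∑< k f ≡ sum {k} (f ∘ toℕ)
∑≡sum zero    f = refl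
∑≡sum (suc k) f = cong (f 0 +_) (∑≡sum k (f ∘ suc))

∑-permute : ∀ k (π : ℕ → ℕ) → (∀ j → π j < k) → (∀ {i j} → i < k → j < k → π i ≡ π j → i ≡ j) →
            ∀ g → ∑[ j < k ] g (π j) ≡ ∑< k g
∑-permute k π π<k π-inj g = begin
  ∑[ j < k ] g (π j)           ≡⟨ ∑≡sum k (g ∘ π) ⟩
  sum {k} (g ∘ π ∘ toℕ)        ≡⟨ sum-cong-≗ {k} (λ i → cong g (sym (toℕ-fromℕ< (π<k (toℕ i))))) ⟩
  sum {k} (g ∘ toℕ ∘ πᶠ)       ≡⟨ sym (sum-permute (g ∘ toℕ) σ) ⟩
  sum {k} (g ∘ toℕ)            ≡⟨ sym (∑≡sum k g) ⟩
  ∑< k g                       ∎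
  where
  open ≡-Reasoning
  πᶠ : Fin k → Fin k
  πᶠ i = fromℕ< (π<k (toℕ i))
  πᶠ-inj : Injective _≡_ _≡_ πᶠ
  πᶠ-inj {i} {j} eq = toℕ-injective (π-inj (toℕ<n i) (toℕ<n j)
    (trans (sym (toℕ-fromℕ< (π<k (toℕ i)))) (trans (cong toℕ eq) (toℕ-fromℕ< (π<k (toℕ j))))))
  surj : ∀ i → ∃ λ j → πᶠ j ≡ i
  surj = injective⇒surjective πᶠ-inj
  σ : Permutation k k
  σ = permutation πᶠ (proj₁ ∘ surj) (proj₂ ∘ surj) (λ i → πᶠ-inj (proj₂ (surj (πᶠ i))))

𝟙 : ∀ {p} {P : Set p} → Dec P → ℕ
𝟙 (yes _) = 1
𝟙 (no _)  = 0

module _ {p} {P : Set p} where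

  𝟙-yes : (P? : Dec P) → P → 𝟙 P? ≡ 1
  𝟙-yes (yes _) _  = refl
  𝟙-yes (no ¬p) p = contradiction p ¬p

  𝟙-no : (P? : Dec P) → ¬ P → 𝟙 P? ≡ 0
  𝟙-no (yes p) ¬p = contradiction p ¬p
  𝟙-no (no _)  _  = refl

module _ {p q} {P : Set p} {Q : Set q} where

  𝟙-cong : (P? : Dec P) (Q? : Dec Q) → P ⇔ Q → 𝟙 P? ≡ 𝟙 Q?
  𝟙-cong (yes p) Q? P⇔Q = sym (𝟙-yes Q? (Equivalence.to P⇔Q p))
  𝟙-cong (no ¬p) Q? P⇔Q = sym (𝟙-no Q? (¬p ∘ Equivalence.from P⇔Q))

  𝟙-× : (P? : Dec P) (Q? : Dec Q) (P×Q? : Dec (P × Q)) → 𝟙 P×Q? ≡ 𝟙 P? * 𝟙 Q?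
  𝟙-× (yes p) (yes q) P×Q? = 𝟙-yes P×Q? (p , q)
  𝟙-× (yes p) (no ¬q) P×Q? = 𝟙-no P×Q? (¬q ∘ proj₂)
  𝟙-× (no ¬p) Q?      P×Q? = 𝟙-no P×Q? (¬p ∘ proj₁)

  𝟙-×¬ : (P? : Dec P) (Q? : Dec Q) (P×¬Q? : Dec (P × ¬ Q)) → 𝟙 P×¬Q? + 𝟙 Q? * 𝟙 P? ≡ 𝟙 P?
  𝟙-×¬ (yes p) (yes q) P×¬Q? = cong (_+ 1) (𝟙-no P×¬Q? (λ (_ , ¬q) → ¬q q))
  𝟙-×¬ (yes p) (no ¬q) P×¬Q? = cong (_+ 0) (𝟙-yes P×¬Q? (p , ¬q))
  𝟙-×¬ (no ¬p) Q?      P×¬Q? = cong₂ _+_ (𝟙-no P×¬Q? (¬p ∘ proj₁)) (*-zeroʳ (𝟙 Q?))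

module _ {P : ℕ → Set} (P? : Decidable P) where

  length-filter-applyUpTo : ∀ f L → length (filter P? (applyUpTo f L)) ≡ ∑[ j < L ] 𝟙 (P? (f j))
  length-filter-applyUpTo f zero = refl
  length-filter-applyUpTo f (suc L) with P? (f 0)
  ... | yes _ = cong suc (length-filter-applyUpTo (f ∘ suc) L)
  ... | no _  = length-filter-applyUpTo (f ∘ suc) L

  hasCard-window : ∀ N L → HasCard (λ m → (N ≤ m × m < N + L) × P m) (∑[ j < L ] 𝟙 (P? (N + j)))
  hasCard-window N L = filter P? window
                     , filter⁺ P? (applyUpTo⁺₁ (N +_) L (λ i<j _ → <⇒≢ (+-monoʳ-< N i<j)))
                     , length-filter-applyUpTo (N +_) L
                     , λ m → mk⇔ (λ m∈ → let m∈window , p = ∈-filter⁻ P? m∈ in ∈window⇒ m∈window , p)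
                                 (λ (bounds , p) → ∈-filter⁺ P? (⇒∈window bounds) p)
    where
    window : List ℕ
    window = applyUpTo (N +_) L
    ∈window⇒ : ∀ {m} → m ∈ window → N ≤ m × m < N + L
    ∈window⇒ m∈ with i , i<L , refl ← ∈-applyUpTo⁻ (N +_) m∈ = m≤m+n N i , +-monoʳ-< N i<L
    ⇒∈window : ∀ {m} → N ≤ m × m < N + L → m ∈ window
    ⇒∈window {m} (N≤m , m<N+L) = subst (_∈ window) (m+[n∸m]≡n N≤m)
      (∈-applyUpTo⁺ (N +_) (subst (m ∸ N <_) (m+n∸m≡n N L) (∸-monoˡ-< m<N+L N≤m)))

∑𝟙[n≤i+c]≡c : ∀ n c → c ≤ n → ∑[ i < n ] 𝟙 (n ≤? i + c) ≡ c
∑𝟙[n≤i+c]≡c n c c≤n = begin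
  ∑< n F                          ≡⟨ cong (λ L → ∑< L F) (sym n∸c+c≡n) ⟩
  ∑< (n ∸ c + c) F                ≡⟨ ∑-split (n ∸ c) c F ⟩
  ∑< (n ∸ c) F + ∑[ j < c ] F (n ∸ c + j)
    ≡⟨ cong₂ _+_ (∑-zero (n ∸ c) (λ i<n∸c → 𝟙-no _ (<⇒≱ (subst (_ <_) n∸c+c≡n (+-monoˡ-< c i<n∸c)))))
                 (∑-cong c (λ {j} _ → 𝟙-yes _ (subst (_≤ n ∸ c + j + c) n∸c+c≡n (+-monoˡ-≤ c (m≤m+n (n ∸ c) j))))) ⟩
  ∑[ j < c ] 1                    ≡⟨ trans (∑-const c 1) (*-identityʳ c) ⟩
  c                               ∎
  where
  open ≡-Reasoning
  F : ℕ → ℕ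
  F i = 𝟙 (n ≤? i + c)
  n∸c+c≡n : n ∸ c + c ≡ n
  n∸c+c≡n = m∸n+n≡m c≤n

∑𝟙[i+c<n]≡n∸c : ∀ n c → c ≤ n → ∑[ i < n ] 𝟙 (i + c <? n) ≡ n ∸ c
∑𝟙[i+c<n]≡n∸c n c c≤n = begin
  ∑< n F                          ≡⟨ cong (λ L → ∑< L F) (sym n∸c+c≡n) ⟩
  ∑< (n ∸ c + c) F                ≡⟨ ∑-split (n ∸ c) c F ⟩
  ∑< (n ∸ c) F + ∑[ j < c ] F (n ∸ c + j)
    ≡⟨ cong₂ _+_ (∑-cong (n ∸ c) (λ i<n∸c → 𝟙-yes _ (subst (_ <_) n∸c+c≡n (+-monoˡ-< c i<n∸c))))
                 (∑-zero c (λ {j} _ → 𝟙-no _ (≤⇒≯ (subst (_≤ n ∸ c + j + c) n∸c+c≡n (+-monoˡ-≤ c (m≤m+n (n ∸ c) j)))))) ⟩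
  ∑[ i < n ∸ c ] 1 + 0            ≡⟨ trans (+-identityʳ _) (trans (∑-const (n ∸ c) 1) (*-identityʳ (n ∸ c))) ⟩
  n ∸ c                           ∎
  where
  open ≡-Reasoning
  F : ℕ → ℕ
  F i = 𝟙 (i + c <? n)
  n∸c+c≡n : n ∸ c + c ≡ n
  n∸c+c≡n = m∸n+n≡m c≤n

%-≡⇒∣ : ∀ x d n .{{_ : NonZero n}} → (x + d) % n ≡ x % n → n ∣ d
%-≡⇒∣ x d n eq = ∣m+n∣m⇒∣n (divides ((x + d) / n) (+-cancelˡ-≡ (x % n) _ _ split)) (n∣m*n (x / n))
  where
  open ≡-Reasoning
  split : x % n + (x / n * n + d) ≡ x % n + (x + d) / n * n
  split = begin
    x % n + (x / n * n + d)      ≡⟨ sym (+-assoc (x % n) _ d) ⟩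
    x % n + x / n * n + d        ≡⟨ cong (_+ d) (sym (m≡m%n+[m/n]*n x n)) ⟩
    x + d                        ≡⟨ m≡m%n+[m/n]*n (x + d) n ⟩
    (x + d) % n + (x + d) / n * n ≡⟨ cong (_+ (x + d) / n * n) eq ⟩
    x % n + (x + d) / n * n      ∎

∣∧<⇒≡0 : ∀ {n d} → n ∣ d → d < n → d ≡ 0
∣∧<⇒≡0 {d = zero}  _   _   = refl
∣∧<⇒≡0 {d = suc _} n∣d d<n = contradiction n∣d (>⇒∤ d<n)

module _ {m n : ℕ} (r : ℕ) .{{_ : NonZero n}} (coprime : Coprime n m) where

  [i*m+r]%n-injective≤ : ∀ {i j} → i ≤ j → j < n → (i * m + r) % n ≡ (j * m + r) % n → i ≡ j
  [i*m+r]%n-injective≤ {i} {j} i≤j j<n eq = begin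
    i          ≡⟨ sym (+-identityʳ i) ⟩
    i + 0      ≡⟨ cong (i +_) (sym d≡0) ⟩
    i + d      ≡⟨ i+d≡j ⟩
    j          ∎
    where
    open ≡-Reasoning
    d : ℕ
    d = j ∸ i
    i+d≡j : i + d ≡ j
    i+d≡j = m+[n∸m]≡n i≤j
    shift : (i * m + r + d * m) % n ≡ (i * m + r) % n
    shift = trans (cong (_% n) (trans (ring i d m r) (cong (λ k → k * m + r) i+d≡j))) (sym eq)
      where
      ring : ∀ i d m r → i * m + r + d * m ≡ (i + d) * m + r
      ring = solve-∀
    d≡0 : d ≡ 0
    d≡0 = ∣∧<⇒≡0 (coprime-divisor coprime (subst (n ∣_) (*-comm d m) (%-≡⇒∣ (i * m + r) (d * m) n shift)))
                 (≤-<-trans (m∸n≤m j i) j<n)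

  [i*m+r]%n-injective : ∀ {i j} → i < n → j < n → (i * m + r) % n ≡ (j * m + r) % n → i ≡ j
  [i*m+r]%n-injective {i} {j} i<n j<n eq with ≤-total i j
  ... | inj₁ i≤j = [i*m+r]%n-injective≤ i≤j j<n eq
  ... | inj₂ j≤i = sym ([i*m+r]%n-injective≤ j≤i i<n (sym eq))

-- Writing k = j * m + i, the row j ↦ (j * m + i) % n permutes [0, n) since m is invertible mod n.
∑-crt : ∀ m n .{{_ : NonZero m}} .{{_ : NonZero n}} → Coprime m n → ∀ f g →
        ∑[ k < m * n ] (f (k % m) * g (k % n)) ≡ ∑< m f * ∑< n g
∑-crt m n coprime f g = begin
  ∑[ k < m * n ] F k                                      ≡⟨ cong (λ L → ∑< L F) (*-comm m n) ⟩
  ∑[ k < n * m ] F k                                      ≡⟨ ∑-blocks n m F ⟩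
  ∑[ j < n ] ∑[ i < m ] F (j * m + i)                     ≡⟨ ∑-cong n (λ {j} _ → ∑-cong m λ {i} i<m →
                                                               cong (λ r → f r * g ((j * m + i) % n)) ([j*m+i]%m≡i j i<m)) ⟩
  ∑[ j < n ] ∑[ i < m ] (f i * g ((j * m + i) % n))       ≡⟨ ∑-comm n m _ ⟩
  ∑[ i < m ] ∑[ j < n ] (f i * g ((j * m + i) % n))       ≡⟨ ∑-cong m (λ {i} _ → trans (∑-distribˡ-* n (f i) _)
                                                               (cong (f i *_) (∑-permute n _ (λ j → m%n<n _ n)
                                                                 ([i*m+r]%n-injective i (Coprime.sym coprime)) g))) ⟩
  ∑[ i < m ] (f i * ∑< n g)                               ≡⟨ ∑-distribʳ-* m (∑< n g) f ⟩
  ∑< m f * ∑< n g                                         ∎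
  where
  open ≡-Reasoning
  F : ℕ → ℕ
  F k = f (k % m) * g (k % n)
  [j*m+i]%m≡i : ∀ j {i} → i < m → (j * m + i) % m ≡ i
  [j*m+i]%m≡i j {i} i<m = trans (cong (_% m) (+-comm (j * m) i)) (trans ([m+kn]%n≡m%n i j m) (m<n⇒m%n≡m i<m))

module StrictlyIncreasing (f : ℕ → ℕ) (f-mono-< : f Preserves _<_ ⟶ _<_) where

  Image : ℕ → Set
  Image m = ∃ λ n → f n ≡ m

  f-mono-≤ : f Preserves _≤_ ⟶ _≤_
  f-mono-≤ m≤n with m≤n⇒m<n∨m≡n m≤n
  ... | inj₁ m<n  = <⇒≤ (f-mono-< m<n)
  ... | inj₂ refl = ≤-refl

  n≤f[n] : ∀ n → n ≤ f n
  n≤f[n] zero    = z≤n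
  n≤f[n] (suc n) = ≤-<-trans (n≤f[n] n) (f-mono-< (n<1+n n))

  image? : Decidable Image
  image? m with anyUpTo? (λ n → f n ≟ m) (suc m)
  ... | yes (n , _ , fn≡m) = yes (n , fn≡m)
  ... | no ∄n             = no λ (n , fn≡m) → ∄n (n , s≤s (subst (n ≤_) fn≡m (n≤f[n] n)) , fn≡m)

  ∉image : ∀ k {m} → f k < m → m < f (suc k) → ¬ Image m
  ∉image k fk<m m<fk+1 (n , refl) with n ≤? k
  ... | yes n≤k = <⇒≱ fk<m (f-mono-≤ n≤k)
  ... | no  n≰k = <⇒≱ m<fk+1 (f-mono-≤ (≰⇒> n≰k))

  module _ (f0≡0 : f 0 ≡ 0) where

    ∑-image : ∀ F k → ∑[ m < f k ] (𝟙 (image? m) * F m) ≡ ∑[ n < k ] F (f n)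
    ∑-image F zero    = cong (λ L → ∑[ m < L ] (𝟙 (image? m) * F m)) f0≡0
    ∑-image F (suc k) = begin
      ∑< (f (suc k)) G                                         ≡⟨ cong (λ L → ∑< L G) (sym fk+1+d≡) ⟩
      ∑< (f k + suc d) G                                       ≡⟨ ∑-split (f k) (suc d) G ⟩
      ∑< (f k) G + (G (f k + 0) + ∑[ j < d ] G (f k + suc j))  ≡⟨ cong₂ (λ x y → ∑< (f k) G + (x + y)) hit gap ⟩
      ∑< (f k) G + (F (f k) + 0)                               ≡⟨ cong₂ _+_ (∑-image F k) (+-identityʳ _) ⟩
      ∑[ n < k ] F (f n) + F (f k)                             ≡⟨ sym (∑-last k (F ∘ f)) ⟩
      ∑[ n < suc k ] F (f n)                                   ∎
      where
      open ≡-Reasoning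
      G : ℕ → ℕ
      G m = 𝟙 (image? m) * F m
      d : ℕ
      d = f (suc k) ∸ suc (f k)
      fk+1+d≡ : f k + suc d ≡ f (suc k)
      fk+1+d≡ = trans (+-suc (f k) d) (m+[n∸m]≡n (f-mono-< (n<1+n k)))
      hit : G (f k + 0) ≡ F (f k)
      hit = trans (cong G (+-identityʳ (f k)))
                  (trans (cong (_* F (f k)) (𝟙-yes (image? (f k)) (k , refl))) (*-identityˡ (F (f k))))
      gap : ∑[ j < d ] G (f k + suc j) ≡ 0
      gap = ∑-zero d λ {j} j<d → cong (_* F (f k + suc j)) (𝟙-no (image? _)
              (∉image k (m<m+n (f k) z<s) (subst (f k + suc j <_) fk+1+d≡ (+-monoʳ-< (f k) (s<s j<d)))))

    image-+-period : ∀ {K H} → (∀ n → f (n + K) ≡ f n + H) → ∀ m → Image (m + H) ⇔ Image m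
    image-+-period {K} {H} f-period m = mk⇔ backward forward
      where
      fK≡H : f K ≡ H
      fK≡H = trans (f-period 0) (cong (_+ H) f0≡0)
      forward : Image m → Image (m + H)
      forward (n , fn≡m) = n + K , trans (f-period n) (cong (_+ H) fn≡m)
      backward : Image (m + H) → Image m
      backward (n , fn≡m+H) with n <? K
      ... | yes n<K = contradiction (subst (_ <_) fK≡H (f-mono-< n<K)) (≤⇒≯ (subst (H ≤_) (sym fn≡m+H) (m≤n+m H m)))
      ... | no  n≮K = n ∸ K , +-cancelʳ-≡ H _ _ (trans (sym (f-period (n ∸ K))) (trans (cong f (m∸n+n≡m (≮⇒≥ n≮K))) fn≡m+H))

[m+n]/d≡m/d+[m%d+n]/d : ∀ m n d .{{_ : NonZero d}} → (m + n) / d ≡ m / d + (m % d + n) / d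
[m+n]/d≡m/d+[m%d+n]/d m n d = begin
  (m + n) / d                          ≡⟨ cong (λ x → (x + n) / d) (m≡m%n+[m/n]*n m d) ⟩
  (m % d + m / d * d + n) / d          ≡⟨ cong (_/ d) (ring (m % d) (m / d * d) n) ⟩
  (m % d + n + m / d * d) / d          ≡⟨ +-distrib-/-∣ʳ (m % d + n) (n∣m*n (m / d)) ⟩
  (m % d + n) / d + m / d * d / d      ≡⟨ cong ((m % d + n) / d +_) (m*n/n≡m (m / d) d) ⟩
  (m % d + n) / d + m / d              ≡⟨ +-comm _ (m / d) ⟩
  m / d + (m % d + n) / d              ∎
  where
  open ≡-Reasoning
  ring : ∀ r q n → r + q + n ≡ r + n + q
  ring = solve-∀

m/n≡1⇔n≤m : ∀ {m n} .{{_ : NonZero n}} → m < n + n → (m / n ≡ 1 ⇔ n ≤ m)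
m/n≡1⇔n≤m {m} {n} m<n+n = mk⇔ n≤m (λ n≤m → trans (m/n≡1+[m∸n]/n n≤m) (cong suc (m<n⇒m/n≡0 (m∸n<n n≤m))))
  where
  n≤m : m / n ≡ 1 → n ≤ m
  n≤m m/n≡1 = ≮⇒≥ (λ m<n → 0≢1+n (trans (sym (m<n⇒m/n≡0 m<n)) m/n≡1))
  m∸n<n : n ≤ m → m ∸ n < n
  m∸n<n n≤m = subst (m ∸ n <_) (m+n∸m≡n n n) (∸-monoˡ-< m<n+n n≤m)

module _ (a δ : ℕ) .{{_ : NonZero a}} .{{_ : NonZero δ}} where

  w-mono-< : w a δ Preserves _<_ ⟶ _<_
  w-mono-< m<n = +-mono-<-≤ (+-mono-<-≤ m<n (*-monoʳ-≤ a (/-monoˡ-≤ a (<⇒≤ m<n))))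
                            (*-monoʳ-≤ (a + δ) (/-monoˡ-≤ δ (<⇒≤ m<n)))

  w-zero : w a δ 0 ≡ 0
  w-zero = begin
    0 + a * (0 / a) + (a + δ) * (0 / δ) ≡⟨ cong₂ (λ x y → a * x + (a + δ) * y) (0/n≡0 a) (0/n≡0 δ) ⟩
    a * 0 + (a + δ) * 0                 ≡⟨ cong₂ _+_ (*-zeroʳ a) (*-zeroʳ (a + δ)) ⟩
    0                                   ∎
    where open ≡-Reasoning

  w-+ : ∀ n t → w a δ (n + t) ≡ w a δ n + t + a * ((n % a + t) / a) + (a + δ) * ((n % δ + t) / δ)
  w-+ n t = begin
    n + t + a * ((n + t) / a) + (a + δ) * ((n + t) / δ)
      ≡⟨ cong₂ (λ x y → n + t + a * x + (a + δ) * y) ([m+n]/d≡m/d+[m%d+n]/d n t a) ([m+n]/d≡m/d+[m%d+n]/d n t δ) ⟩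
    n + t + a * (n / a + (n % a + t) / a) + (a + δ) * (n / δ + (n % δ + t) / δ)
      ≡⟨ ring n t a (n / a) ((n % a + t) / a) (a + δ) (n / δ) ((n % δ + t) / δ) ⟩
    w a δ n + t + a * ((n % a + t) / a) + (a + δ) * ((n % δ + t) / δ)
      ∎
    where
    open ≡-Reasoning
    ring : ∀ n t a p A b q B → n + t + a * (p + A) + b * (q + B) ≡ n + a * p + b * q + t + a * A + b * B
    ring = solve-∀

  w-period : ∀ n → w a δ (n + a * δ) ≡ w a δ n + heapPeriod a δ
  w-period n = begin
    n + a * δ + a * ((n + a * δ) / a) + (a + δ) * ((n + a * δ) / δ) ≡⟨ cong₂ (λ x y → n + a * δ + a * x + (a + δ) * y) /a /δ ⟩
    n + a * δ + a * (n / a + δ) + (a + δ) * (n / δ + a)             ≡⟨ ring n a δ (n / a) (n / δ) ⟩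
    w a δ n + heapPeriod a δ                                        ∎
    where
    open ≡-Reasoning
    /a : (n + a * δ) / a ≡ n / a + δ
    /a = trans (+-distrib-/-∣ʳ n (m∣m*n δ)) (cong (n / a +_) (trans (cong (_/ a) (*-comm a δ)) (m*n/n≡m δ a)))
    /δ : (n + a * δ) / δ ≡ n / δ + a
    /δ = trans (+-distrib-/-∣ʳ n (n∣m*n a)) (cong (n / δ +_) (m*n/n≡m a δ))
    ring : ∀ n a δ p q → n + a * δ + a * (p + δ) + (a + δ) * (q + a) ≡ n + a * p + (a + δ) * q + (3 * δ + a) * a
    ring = solve-∀

module W-sets (a δ : ℕ) .{{_ : NonZero a}} .{{_ : NonZero δ}} where

  open StrictlyIncreasing (w a δ) (w-mono-< a δ) public

  h : ℕ
  h = heapPeriod a δ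

  InW3? : Decidable (InW3 a δ)
  InW3? m = image? (m + δ) ×-dec ¬? (image? m)

  InW0-+-period : ∀ m → InW0 a δ (m + h) ⇔ InW0 a δ m
  InW0-+-period = image-+-period (w-zero a δ) (w-period a δ)

  InW3-+-period : ∀ m → InW3 a δ (m + h) ⇔ InW3 a δ m
  InW3-+-period m = subst (λ x → InW0 a δ x ⇔ InW0 a δ (m + δ)) ([x+y]+z≡[x+z]+y m δ h) (InW0-+-period (m + δ))
                  ×-⇔ ¬-cong-⇔ (InW0-+-period m)

  wK≡h : w a δ (a * δ) ≡ h
  wK≡h = trans (w-period a δ 0) (cong (_+ h) (w-zero a δ))

  ∑-period-image : ∀ F → ∑[ m < h ] (𝟙 (image? m) * F m) ≡ ∑[ n < a * δ ] F (w a δ n)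
  ∑-period-image F = trans (cong (λ L → ∑[ m < L ] (𝟙 (image? m) * F m)) (sym wK≡h)) (∑-image (w-zero a δ) F (a * δ))

  ∑-W0 : ∑[ m < h ] 𝟙 (image? m) ≡ a * δ
  ∑-W0 = begin
    ∑[ m < h ] 𝟙 (image? m)         ≡⟨ ∑-cong h (λ {m} _ → sym (*-identityʳ (𝟙 (image? m)))) ⟩
    ∑[ m < h ] (𝟙 (image? m) * 1)   ≡⟨ ∑-period-image (λ _ → 1) ⟩
    ∑[ n < a * δ ] 1                ≡⟨ trans (∑-const (a * δ) 1) (*-identityʳ (a * δ)) ⟩
    a * δ                           ∎
    where open ≡-Reasoning

  ∑-W0-δ : ∑[ m < h ] 𝟙 (image? (m + δ)) ≡ a * δ
  ∑-W0-δ = begin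
    ∑[ m < h ] 𝟙 (image? (m + δ))   ≡⟨ ∑-cong h (λ {m} _ → cong (𝟙 ∘ image?) (+-comm m δ)) ⟩
    ∑[ m < h ] 𝟙 (image? (δ + m))   ≡⟨ ∑-periodic h (λ m → 𝟙-cong _ _ (InW0-+-period m)) δ ⟩
    ∑[ m < h ] 𝟙 (image? m)         ≡⟨ ∑-W0 ⟩
    a * δ                           ∎
    where open ≡-Reasoning

module W3-count (a δ : ℕ) .{{_ : NonZero a}} .{{_ : NonZero δ}} (a<δ : a < δ) (δ<2a : δ < 2 * a) where

  open W-sets a δ

  c : ℕ
  c = δ ∸ a

  a+c≡δ : a + c ≡ δ
  a+c≡δ = m+[n∸m]≡n (<⇒≤ a<δ)

  c<a : c < a
  c<a = +-cancelˡ-< a c a (subst₂ _<_ (sym a+c≡δ) (cong (a +_) (+-identityʳ a)) δ<2a)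

  no-carry-mod-δ : ∀ {s B} → s + (a + δ) * B ≡ δ → B ≡ 0
  no-carry-mod-δ {B = zero}      _      = refl
  no-carry-mod-δ {s} {B = suc B} s+bB≡δ = contradiction s+bB≡δ (>⇒≢ (begin-strict
    δ                  <⟨ m<n+m δ (≤-<-trans z≤n c<a) ⟩
    a + δ              ≤⟨ m≤m*n (a + δ) (suc B) ⟩
    (a + δ) * suc B    ≤⟨ m≤n+m _ s ⟩
    s + (a + δ) * suc B ∎))
    where open ≤-Reasoning

  one-carry-mod-a : ∀ {t A} → t + a * A ≡ δ → t < δ → A ≡ 1 × t ≡ c
  one-carry-mod-a {t} {zero}        t+aA≡δ t<δ = contradiction (trans t≡t+a*0 t+aA≡δ) (<⇒≢ t<δ)
    where
    t≡t+a*0 : t ≡ t + a * 0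
    t≡t+a*0 = sym (trans (cong (t +_) (*-zeroʳ a)) (+-identityʳ t))
  one-carry-mod-a {t} {suc zero}    t+aA≡δ _   = refl , (begin
    t              ≡⟨ sym (m+n∸n≡m t a) ⟩
    t + a ∸ a      ≡⟨ cong (λ x → t + x ∸ a) (sym (*-identityʳ a)) ⟩
    t + a * 1 ∸ a  ≡⟨ cong (_∸ a) t+aA≡δ ⟩
    c              ∎)
    where open ≡-Reasoning
  one-carry-mod-a {t} {suc (suc A)} t+aA≡δ _   = contradiction t+aA≡δ (>⇒≢ (begin-strict
    δ                  <⟨ δ<2a ⟩
    2 * a              ≡⟨ *-comm 2 a ⟩
    a * 2              ≤⟨ *-monoʳ-≤ a (s≤s (s≤s z≤n)) ⟩
    a * suc (suc A)    ≤⟨ m≤n+m _ t ⟩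
    t + a * suc (suc A) ∎))
    where open ≤-Reasoning

  CarryModAOnly : ℕ → Set
  CarryModAOnly n = a ≤ n % a + c × n % δ + c < δ

  carry? : Decidable CarryModAOnly
  carry? n = (a ≤? n % a + c) ×-dec (n % δ + c <? δ)

  [n%a+c]/a≡1⇔ : ∀ n → (n % a + c) / a ≡ 1 ⇔ a ≤ n % a + c
  [n%a+c]/a≡1⇔ n = m/n≡1⇔n≤m (+-mono-< (m%n<n n a) c<a)

  carry⇒w+δ∈W0 : ∀ n → CarryModAOnly n → InW0 a δ (w a δ n + δ)
  carry⇒w+δ∈W0 n (a≤n%a+c , n%δ+c<δ) = n + c , (begin
    w a δ (n + c)                                                       ≡⟨ w-+ a δ n c ⟩
    w a δ n + c + a * ((n % a + c) / a) + (a + δ) * ((n % δ + c) / δ)   ≡⟨ cong₂ (λ A B → w a δ n + c + a * A + (a + δ) * B)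
                                                                             (Equivalence.from ([n%a+c]/a≡1⇔ n) a≤n%a+c)
                                                                             (m<n⇒m/n≡0 n%δ+c<δ) ⟩
    w a δ n + c + a * 1 + (a + δ) * 0                                   ≡⟨ ring (w a δ n) c a (a + δ) ⟩
    w a δ n + (a + c)                                                   ≡⟨ cong (w a δ n +_) a+c≡δ ⟩
    w a δ n + δ                                                         ∎)
    where
    open ≡-Reasoning
    ring : ∀ x c a b → x + c + a * 1 + b * 0 ≡ x + (a + c)
    ring = solve-∀

  δ-jump : ∀ n t → w a δ (n + t) ≡ w a δ n + δ → (n % a + t) / a ≡ 1 × (n % δ + t) / δ ≡ 0 × t ≡ c
  δ-jump n t w[n+t]≡w[n]+δ = A≡1 , B≡0 , t≡c
    where
    open ≡-Reasoning
    A B : ℕ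
    A = (n % a + t) / a
    B = (n % δ + t) / δ
    t+aA+bB≡δ : t + a * A + (a + δ) * B ≡ δ
    t+aA+bB≡δ = +-cancelˡ-≡ (w a δ n) _ _ (begin
      w a δ n + (t + a * A + (a + δ) * B)   ≡⟨ ring (w a δ n) t (a * A) ((a + δ) * B) ⟩
      w a δ n + t + a * A + (a + δ) * B     ≡⟨ sym (w-+ a δ n t) ⟩
      w a δ (n + t)                         ≡⟨ w[n+t]≡w[n]+δ ⟩
      w a δ n + δ                           ∎)
      where
      ring : ∀ x t p q → x + (t + p + q) ≡ x + t + p + q
      ring = solve-∀
    B≡0 : B ≡ 0
    B≡0 = no-carry-mod-δ t+aA+bB≡δ
    t+aA≡δ : t + a * A ≡ δ
    t+aA≡δ = begin
      t + a * A                  ≡⟨ sym (+-identityʳ _) ⟩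
      t + a * A + 0              ≡⟨ cong (t + a * A +_) (sym (trans (cong ((a + δ) *_) B≡0) (*-zeroʳ (a + δ)))) ⟩
      t + a * A + (a + δ) * B    ≡⟨ t+aA+bB≡δ ⟩
      δ                          ∎
    t<δ : t < δ
    t<δ = ≤-<-trans (m≤n+m t (n % δ)) (m/n≡0⇒m<n B≡0)
    A≡1 : A ≡ 1
    A≡1 = proj₁ (one-carry-mod-a t+aA≡δ t<δ)
    t≡c : t ≡ c
    t≡c = proj₂ (one-carry-mod-a t+aA≡δ t<δ)

  w+δ∈W0⇒carry : ∀ n → InW0 a δ (w a δ n + δ) → CarryModAOnly n
  w+δ∈W0⇒carry n (k , w[k]≡w[n]+δ) with k ≤? n
  ... | yes k≤n = contradiction (f-mono-≤ k≤n) (<⇒≱ (subst (w a δ n <_) (sym w[k]≡w[n]+δ) (m<m+n _ (≤-<-trans z≤n a<δ))))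
  ... | no  k≰n with A≡1 , B≡0 , t≡c ← δ-jump n (k ∸ n) (trans (cong (w a δ) (m+[n∸m]≡n (<⇒≤ (≰⇒> k≰n)))) w[k]≡w[n]+δ)
    = Equivalence.to ([n%a+c]/a≡1⇔ n) (subst (λ t → (n % a + t) / a ≡ 1) t≡c A≡1)
    , m/n≡0⇒m<n (subst (λ t → (n % δ + t) / δ ≡ 0) t≡c B≡0)

  w+δ∈W0⇔carry : ∀ n → InW0 a δ (w a δ n + δ) ⇔ CarryModAOnly n
  w+δ∈W0⇔carry n = mk⇔ (w+δ∈W0⇒carry n) (carry⇒w+δ∈W0 n)

  ∑-W0∩[W0-δ] : Coprime a δ → ∑[ m < h ] (𝟙 (image? m) * 𝟙 (image? (m + δ))) ≡ c * a
  ∑-W0∩[W0-δ] coprime = begin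
    ∑[ m < h ] (𝟙 (image? m) * 𝟙 (image? (m + δ)))             ≡⟨ ∑-period-image (λ m → 𝟙 (image? (m + δ))) ⟩
    ∑[ n < a * δ ] 𝟙 (image? (w a δ n + δ))                     ≡⟨ ∑-cong (a * δ) (λ {n} _ →
                                                                     trans (𝟙-cong _ _ (w+δ∈W0⇔carry n)) (𝟙-× (a ≤? n % a + c) (n % δ + c <? δ) (carry? n))) ⟩
    ∑[ n < a * δ ] (𝟙 (a ≤? n % a + c) * 𝟙 (n % δ + c <? δ))     ≡⟨ ∑-crt a δ coprime (λ i → 𝟙 (a ≤? i + c)) (λ j → 𝟙 (j + c <? δ)) ⟩
    ∑[ i < a ] 𝟙 (a ≤? i + c) * ∑[ j < δ ] 𝟙 (j + c <? δ)       ≡⟨ cong₂ _*_ (∑𝟙[n≤i+c]≡c a c (<⇒≤ c<a))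
                                                                     (trans (∑𝟙[i+c<n]≡n∸c δ c (m∸n≤m δ a)) (m∸[m∸n]≡n (<⇒≤ a<δ))) ⟩
    c * a                                                        ∎
    where open ≡-Reasoning

  ∑-W3 : Coprime a δ → ∑[ m < h ] 𝟙 (InW3? m) ≡ a * a
  ∑-W3 coprime = +-cancelʳ-≡ (c * a) _ _ (begin
    ∑[ m < h ] 𝟙 (InW3? m) + c * a                               ≡⟨ cong (∑[ m < h ] 𝟙 (InW3? m) +_) (sym (∑-W0∩[W0-δ] coprime)) ⟩
    ∑[ m < h ] 𝟙 (InW3? m) + ∑[ m < h ] (Z m * Z (m + δ))        ≡⟨ sym (∑-distrib-+ h _ _) ⟩
    ∑[ m < h ] (𝟙 (InW3? m) + Z m * Z (m + δ))                   ≡⟨ ∑-cong h (λ {m} _ → 𝟙-×¬ (image? (m + δ)) (image? m) (InW3? m)) ⟩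
    ∑[ m < h ] Z (m + δ)                                         ≡⟨ ∑-W0-δ ⟩
    a * δ                                                        ≡⟨ cong (a *_) (sym a+c≡δ) ⟩
    a * (a + c)                                                  ≡⟨ *-distribˡ-+ a a c ⟩
    a * a + a * c                                                ≡⟨ cong (a * a +_) (*-comm a c) ⟩
    a * a + c * a                                                ∎)
    where
    open ≡-Reasoning
    Z : ℕ → ℕ
    Z m = 𝟙 (image? m)

corollary6p1 : (a δ : ℕ) .{{_ : NonZero a}} .{{_ : NonZero δ}} →
    a < δ → δ < 2 * a → gcd a δ ≡ 1 →
    (N : ℕ) →
    HasCard (λ m → (N ≤ m × m < N + heapPeriod a δ) × InW3 a δ m) (a * a)
corollary6p1 a δ a<δ δ<2a gcd≡1 N = subst (HasCard _) count (hasCard-window InW3? N h)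
  where
  open W-sets a δ
  open W3-count a δ a<δ δ<2a
  open ≡-Reasoning
  count : ∑[ j < h ] 𝟙 (InW3? (N + j)) ≡ a * a
  count = begin
    ∑[ j < h ] 𝟙 (InW3? (N + j))   ≡⟨ ∑-periodic h (λ m → 𝟙-cong _ _ (InW3-+-period m)) N ⟩
    ∑[ m < h ] 𝟙 (InW3? m)         ≡⟨ ∑-W3 (gcd≡1⇒coprime gcd≡1) ⟩
    a * a                          ∎
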